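{- Let $\mathcal T\in\{\mathcal T_{\rm CD},\mathcal T_{\rm CDS},\mathcal T_{\rm CDV},\mathcal T_{\rm BCD}\}$ and let $[\sigma\le_{\mathcal T}\tau]$ be the coercion term obtained from a derivation of $\sigma\le_{\mathcal T}\tau$. (1) If $\sigma\le_{\mathcal T}\tau$, then $\vdash^{\mathcal T}_{=_{\beta\eta}}[\sigma\le_{\mathcal T}\tau]:\sigma\to\tau$ and $\lfloor[\sigma\le_{\mathcal T}\tau]\rfloor=_{\beta\eta}\lambda x.x$. (2) If $\sigma\le_{\mathcal T}\tau$ is derived without using the rule schemes $(\to\cap)$, $(\omega_\to)$ and $(\to)$, then $\vdash^{\mathcal T}_{=_\beta}[\sigma\le_{\mathcal T}\tau]:\sigma\to\tau$ and $\lfloor[\sigma\le_{\mathcal T}\tau]\rfloor=_\beta\lambda x.x$.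
   Context: Types: $\mathbb A_\infty=\{a_i\mid i\in\mathbb N\}$, $\omega$ special atom, $\mathbb A^\omega_\infty=\mathbb A_\infty\cup\{\omega\}$; types $\sigma::=\mathbb A\mid\sigma\to\sigma\mid\sigma\cap\sigma$. Minimal type theory: (refl) $\sigma\le\sigma$; (incl) $\sigma\cap\tau\le\sigma,\sigma\cap\tau\le\tau$; (glb) $\rho\le\sigma,\rho\le\tau\Rightarrow\rho\le\sigma\cap\tau$; (trans) $\sigma\le\tau,\tau\le\rho\Rightarrow\sigma\le\rho$. Extras: $(\omega_{top})$ $\sigma\le\omega$; $(\omega_\to)$ $\omega\le\sigma\to\omega$; $(\to\cap)$ $(\sigma\to\tau)\cap(\sigma\to\rho)\le\sigma\to\tau\cap\rho$; $(\to)$ $\sigma_2\le\sigma_1,\tau_1\le\tau_2\Rightarrow\sigma_1\to\tau_1\le\sigma_2\to\tau_2$. $\mathcal T_{\rm CD}$: over $\mathbb A_\infty$, minimal; $\mathcal T_{\rm CDS}$: over $\mathbb A^\omega_\infty$ plus $(\omega_{top})$; $\mathcal T_{\rm CDV}$: over $\mathbb A_\infty$ plus $(\to),(\to\cap)$; $\mathcal T_{\rm BCD}$: over $\mathbb A^\omega_\infty$ plus all four extras. $\Delta$-terms: $\Delta::=u_\Delta\mid x\mid\lambda x{:}\sigma.\Delta\mid\Delta\,\Delta\mid\langle\Delta,\Delta\rangle\mid pr_i\Delta\mid\Delta^\sigma$, $u_\Delta$ a constant indexed by an arbitrary $\Delta$-term. Essence: $\lfloor x\rfloor=x$, $\lfloor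 u_\Delta\rfloor=\lfloor\Delta\rfloor$, $\lfloor\Delta^\sigma\rfloor=\lfloor\Delta\rfloor$, $\lfloor\lambda x{:}\sigma.\Delta\rfloor=\lambda x.\lfloor\Delta\rfloor$, $\lfloor\Delta_1\Delta_2\rfloor=\lfloor\Delta_1\rfloor\lfloor\Delta_2\rfloor$, $\lfloor\langle\Delta_1,\Delta_2\rangle\rfloor=\lfloor\Delta_1\rfloor$, $\lfloor pr_i\Delta\rfloor=\lfloor\Delta\rfloor$. Typed system $\Delta^{\mathcal T}_{\mathcal R}$ ($\mathcal R\in\{=_\beta,=_{\beta\eta}\}$): (top) $B\vdash u_\Delta:\omega$ if $\omega$ is an atom of $\mathcal T$; (ax) $B\vdash x:\sigma$ if $x{:}\sigma\in B$; ($\to I$) $B,x{:}\sigma\vdash\Delta:\tau\Rightarrow B\vdash\lambda x{:}\sigma.\Delta:\sigma\to\tau$; ($\to E$); ($\cap I$) from $B\vdash\Delta_1:\sigma$, $B\vdash\Delta_2:\tau$, $\lfloor\Delta_1\rfloor\mathcal R\lfloor\Delta_2\rfloor$ get $B\vdash\langle\Delta_1,\Delta_2\rangle:\sigma\cap\tau$; ($\cap E_i$) from $\Delta:\sigma\cap\tau$ get $pr_1\Delta:\sigma$, $pr_2\Delta:\tau$; ($\le_{\mathcal T}$) from $\Delta:\sigma$, $\sigma\le_{\mathcal T}\tau$ get $\Delta^\tau:\tau$. Coercion terms, defined by recursion on the derivation of $\sigma\le_{\mathcal T}\tau$: (refl) $[\sigma\le\sigma]=\lambda x{:}\sigma.x$;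 (incl) $[\sigma\cap\tau\le\sigma]=\lambda x{:}\sigma\cap\tau.pr_1x$, $[\sigma\cap\tau\le\tau]=\lambda x{:}\sigma\cap\tau.pr_2x$; (glb) $[\rho\le\sigma\cap\tau]=\lambda x{:}\rho.\langle[\rho\le\sigma]x,[\rho\le\tau]x\rangle$; (trans) $[\sigma\le\rho]=\lambda x{:}\sigma.[\tau\le\rho]([\sigma\le\tau]x)$; $(\omega_{top})$ $[\sigma\le\omega]=\lambda x{:}\sigma.u_x$; $(\omega_\to)$ $[\omega\le\sigma\to\omega]=\lambda f{:}\omega.\lambda x{:}\sigma.u_{(f\,x)}$; $(\to\cap)$ $[(\sigma\to\tau)\cap(\sigma\to\rho)\le\sigma\to\tau\cap\rho]=\lambda f{:}(\sigma\to\tau)\cap(\sigma\to\rho).\lambda x{:}\sigma.\langle(pr_1f)x,(pr_2f)x\rangle$; $(\to)$ $[\sigma_1\to\tau_1\le\sigma_2\to\tau_2]=\lambda f{:}\sigma_1\to\tau_1.\lambda x{:}\sigma_2.[\tau_1\le\tau_2](f([\sigma_2\le\sigma_1]x))$. -}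

module Defs where

open import Data.Nat using (ℕ; zero; suc)
open import Data.List using (List; []; _∷_)
open import Data.Unit using (⊤; tt)
open import Data.Empty using (⊥)
open import Data.Product using (_×_)

data Theory : Set where
  CD CDS CDV BCD : Theory

-- ω is an atom of T (T ∈ {CDS, BCD}); these are also exactly the
-- theories with the axiom (ω_top).
ωAtom : Theory → Set
ωAtom CD  = ⊥
ωAtom CDS = ⊤
ωAtom CDV = ⊥
ωAtom BCD = ⊤

ArrowRules : Theory → Set
ArrowRules CD  = ⊥
ArrowRules CDS = ⊥
ArrowRules CDV = ⊤
ArrowRules BCD = ⊤

infixr 7 _⇒_
infixl 8 _∩_
data Ty (T : Theory) : Set where
  atom : ℕ → Ty T
  ω    : ωAtom T → Ty T
  _⇒_  : Ty T → Ty T → Ty T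
  _∩_  : Ty T → Ty T → Ty T

data Sub : (T : Theory) → Ty T → Ty T → Set where
  refl  : ∀ {T σ} → Sub T σ σ
  incl₁ : ∀ {T σ τ} → Sub T (σ ∩ τ) σ
  incl₂ : ∀ {T σ τ} → Sub T (σ ∩ τ) τ
  glb   : ∀ {T ρ σ τ} → Sub T ρ σ → Sub T ρ τ → Sub T ρ (σ ∩ τ)
  trans : ∀ {T σ τ ρ} → Sub T σ τ → Sub T τ ρ → Sub T σ ρ
  ωtop  : ∀ {T σ} (p : ωAtom T) → Sub T σ (ω p)
  ω→    : ∀ {σ} → Sub BCD (ω tt) (σ ⇒ ω tt)
  →∩    : ∀ {T σ τ ρ} → ArrowRules T →
          Sub T ((σ ⇒ τ) ∩ (σ ⇒ ρ)) (σ ⇒ (τ ∩ ρ))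
  arr   : ∀ {T σ₁ σ₂ τ₁ τ₂} → ArrowRules T →
          Sub T σ₂ σ₁ → Sub T τ₁ τ₂ → Sub T (σ₁ ⇒ τ₁) (σ₂ ⇒ τ₂)

NoArrowRules : ∀ {T σ τ} → Sub T σ τ → Set
NoArrowRules refl        = ⊤
NoArrowRules incl₁       = ⊤
NoArrowRules incl₂       = ⊤
NoArrowRules (glb d e)   = NoArrowRules d × NoArrowRules e
NoArrowRules (trans d e) = NoArrowRules d × NoArrowRules e
NoArrowRules (ωtop p)    = ⊤
NoArrowRules ω→          = ⊥
NoArrowRules (→∩ _)      = ⊥
NoArrowRules (arr _ _ _) = ⊥

data Λ : Set where
  var : ℕ → Λ
  lam : Λ → Λ
  app : Λ → Λ → Λ

ext : (ℕ → ℕ) → ℕ → ℕ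
ext ρ zero    = zero
ext ρ (suc n) = suc (ρ n)

rename : (ℕ → ℕ) → Λ → Λ
rename ρ (var n)   = var (ρ n)
rename ρ (lam M)   = lam (rename (ext ρ) M)
rename ρ (app M N) = app (rename ρ M) (rename ρ N)

exts : (ℕ → Λ) → ℕ → Λ
exts s zero    = var zero
exts s (suc n) = rename suc (s n)

subst : (ℕ → Λ) → Λ → Λ
subst s (var n)   = s n
subst s (lam M)   = lam (subst (exts s) M)
subst s (app M N) = app (subst s M) (subst s N)

_[_] : Λ → Λ → Λ
M [ N ] = subst σ₀ M
  where
  σ₀ : ℕ → Λ
  σ₀ zero    = N
  σ₀ (suc n) = var n

data _→β_ : Λ → Λ → Set where
  β    : ∀ {M N} → app (lam M) N →β (M [ N ])
  ξlam : ∀ {M M'} → M →β M' → lam M →β lam M'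
  ξappL : ∀ {M M' N} → M →β M' → app M N →β app M' N
  ξappR : ∀ {M N N'} → N →β N' → app M N →β app M N'

data _→βη_ : Λ → Λ → Set where
  β    : ∀ {M N} → app (lam M) N →βη (M [ N ])
  η    : ∀ {M} → lam (app (rename suc M) (var zero)) →βη M
  ξlam : ∀ {M M'} → M →βη M' → lam M →βη lam M'
  ξappL : ∀ {M M' N} → M →βη M' → app M N →βη app M' N
  ξappR : ∀ {M N N'} → N →βη N' → app M N →βη app M N'

data Conv (R : Λ → Λ → Set) : Λ → Λ → Set where
  step : ∀ {M N} → R M N → Conv R M N
  refl : ∀ {M} → Conv R M M
  sym  : ∀ {M N} → Conv R M N → Conv R N M
  trans : ∀ {M N P} → Conv R M N → Conv R N P → Conv R M P

_=β_ : Λ → Λ → Set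
_=β_ = Conv _→β_

_=βη_ : Λ → Λ → Set
_=βη_ = Conv _→βη_

data Tm (T : Theory) : Set where
  u    : Tm T → Tm T
  var  : ℕ → Tm T
  lam  : Ty T → Tm T → Tm T
  app  : Tm T → Tm T → Tm T
  pair : Tm T → Tm T → Tm T
  pr₁  : Tm T → Tm T
  pr₂  : Tm T → Tm T
  coe  : Tm T → Ty T → Tm T

⌊_⌋ : ∀ {T} → Tm T → Λ
⌊ u Δ ⌋        = ⌊ Δ ⌋
⌊ var x ⌋      = var x
⌊ lam σ Δ ⌋    = lam ⌊ Δ ⌋
⌊ app Δ₁ Δ₂ ⌋  = app ⌊ Δ₁ ⌋ ⌊ Δ₂ ⌋
⌊ pair Δ₁ Δ₂ ⌋ = ⌊ Δ₁ ⌋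
⌊ pr₁ Δ ⌋      = ⌊ Δ ⌋
⌊ pr₂ Δ ⌋      = ⌊ Δ ⌋
⌊ coe Δ σ ⌋    = ⌊ Δ ⌋

data _∋_∶_ {T : Theory} : List (Ty T) → ℕ → Ty T → Set where
  here  : ∀ {Γ σ} → (σ ∷ Γ) ∋ zero ∶ σ
  there : ∀ {Γ σ τ n} → Γ ∋ n ∶ σ → (τ ∷ Γ) ∋ suc n ∶ σ

data Typed {T : Theory} (R : Λ → Λ → Set) (Γ : List (Ty T)) : Tm T → Ty T → Set where
  top : ∀ {Δ} (p : ωAtom T) → Typed R Γ (u Δ) (ω p)
  ax  : ∀ {x σ} → Γ ∋ x ∶ σ → Typed R Γ (var x) σ
  →I  : ∀ {σ τ Δ} → Typed R (σ ∷ Γ) Δ τ → Typed R Γ (lam σ Δ) (σ ⇒ τ)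
  →E  : ∀ {σ τ Δ₁ Δ₂} → Typed R Γ Δ₁ (σ ⇒ τ) → Typed R Γ Δ₂ σ →
        Typed R Γ (app Δ₁ Δ₂) τ
  ∩I  : ∀ {σ τ Δ₁ Δ₂} → Typed R Γ Δ₁ σ → Typed R Γ Δ₂ τ →
        R ⌊ Δ₁ ⌋ ⌊ Δ₂ ⌋ → Typed R Γ (pair Δ₁ Δ₂) (σ ∩ τ)
  ∩E₁ : ∀ {σ τ Δ} → Typed R Γ Δ (σ ∩ τ) → Typed R Γ (pr₁ Δ) σ
  ∩E₂ : ∀ {σ τ Δ} → Typed R Γ Δ (σ ∩ τ) → Typed R Γ (pr₂ Δ) τ
  ≤T  : ∀ {σ τ Δ} → Typed R Γ Δ σ → Sub T σ τ → Typed R Γ (coe Δ τ) τ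

-- Coercion terms [σ ≤_T τ], by recursion on the derivation
-- (all coercion terms are closed, so no index shifting is needed)

coercion : ∀ {T σ τ} → Sub T σ τ → Tm T
coercion {σ = σ} refl = lam σ (var 0)
coercion (incl₁ {σ = σ₁} {τ₁}) = lam (σ₁ ∩ τ₁) (pr₁ (var 0))
coercion (incl₂ {σ = σ₁} {τ₁}) = lam (σ₁ ∩ τ₁) (pr₂ (var 0))
coercion {σ = ρ} (glb d e) =
  lam ρ (pair (app (coercion d) (var 0)) (app (coercion e) (var 0)))
coercion {σ = σ} (trans d e) = lam σ (app (coercion e) (app (coercion d) (var 0)))
coercion {σ = σ} (ωtop p) = lam σ (u (var 0))
coercion (ω→ {σ}) = lam (ω tt) (lam σ (u (app (var 1) (var 0))))
coercion (→∩ {σ = σ} {τ} {ρ} _) =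
  lam ((σ ⇒ τ) ∩ (σ ⇒ ρ))
      (lam σ (pair (app (pr₁ (var 1)) (var 0)) (app (pr₂ (var 1)) (var 0))))
coercion (arr {σ₁ = σ₁} {σ₂} {τ₁} _ d e) =
  lam (σ₁ ⇒ τ₁) (lam σ₂ (app (coercion e) (app (var 1) (app (coercion d) (var 0)))))

module Submission where

-- The essence of every coercion is the identity: each constructor's coercion erases to
-- λx.x applied around coercions of the subderivations, which β-reduce away, except for
-- (ω→), (→∩) and (→), whose coercions erase to λf.λx.f x and therefore need η.
-- The same conversions discharge the side condition of (∩I) in the typing of (glb).

open import Defs
open import Data.List using (List; [])
open import Data.Product using (_×_; _,_)
open import Data.Unit using (⊤; tt)

IdentityEta : (Λ → Λ → Set) → Set
IdentityEta R = Conv R (lam (lam (app (var 1) (var 0)))) (lam (var 0))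

identityEta-βη : IdentityEta _→βη_
identityEta-βη = step (ξlam η)

ArrowRulesOnlyIf : Set → ∀ {T σ τ} → Sub T σ τ → Set
ArrowRulesOnlyIf E refl        = ⊤
ArrowRulesOnlyIf E incl₁       = ⊤
ArrowRulesOnlyIf E incl₂       = ⊤
ArrowRulesOnlyIf E (glb d e)   = ArrowRulesOnlyIf E d × ArrowRulesOnlyIf E e
ArrowRulesOnlyIf E (trans d e) = ArrowRulesOnlyIf E d × ArrowRulesOnlyIf E e
ArrowRulesOnlyIf E (ωtop p)    = ⊤
ArrowRulesOnlyIf E ω→          = E
ArrowRulesOnlyIf E (→∩ _)      = E
ArrowRulesOnlyIf E (arr _ d e) = E × ArrowRulesOnlyIf E d × ArrowRulesOnlyIf E e

arrowRulesOnlyIf-holds : ∀ {E T σ τ} → E → (d : Sub T σ τ) → ArrowRulesOnlyIf E d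
arrowRulesOnlyIf-holds e refl         = tt
arrowRulesOnlyIf-holds e incl₁        = tt
arrowRulesOnlyIf-holds e incl₂        = tt
arrowRulesOnlyIf-holds e (glb d d′)   = arrowRulesOnlyIf-holds e d , arrowRulesOnlyIf-holds e d′
arrowRulesOnlyIf-holds e (trans d d′) = arrowRulesOnlyIf-holds e d , arrowRulesOnlyIf-holds e d′
arrowRulesOnlyIf-holds e (ωtop p)     = tt
arrowRulesOnlyIf-holds e ω→           = e
arrowRulesOnlyIf-holds e (→∩ _)       = e
arrowRulesOnlyIf-holds e (arr _ d d′) = e , arrowRulesOnlyIf-holds e d , arrowRulesOnlyIf-holds e d′

noArrowRules⇒arrowRulesOnlyIf : ∀ {E T σ τ} (d : Sub T σ τ) →
                                 NoArrowRules d → ArrowRulesOnlyIf E d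
noArrowRules⇒arrowRulesOnlyIf refl        _       = tt
noArrowRules⇒arrowRulesOnlyIf incl₁       _       = tt
noArrowRules⇒arrowRulesOnlyIf incl₂       _       = tt
noArrowRules⇒arrowRulesOnlyIf (glb d e)   (n , m) =
  noArrowRules⇒arrowRulesOnlyIf d n , noArrowRules⇒arrowRulesOnlyIf e m
noArrowRules⇒arrowRulesOnlyIf (trans d e) (n , m) =
  noArrowRules⇒arrowRulesOnlyIf d n , noArrowRules⇒arrowRulesOnlyIf e m
noArrowRules⇒arrowRulesOnlyIf (ωtop p)    _       = tt

Conv-cong : ∀ {R} (f : Λ → Λ) → (∀ {M N} → R M N → R (f M) (f N)) →
            ∀ {M N} → Conv R M N → Conv R (f M) (f N)
Conv-cong f f-mono (step r)     = step (f-mono r)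
Conv-cong f f-mono refl         = refl
Conv-cong f f-mono (sym c)      = sym (Conv-cong f f-mono c)
Conv-cong f f-mono (trans c c′) = trans (Conv-cong f f-mono c) (Conv-cong f f-mono c′)

module Coercions
  (R : Λ → Λ → Set)
  (R-β : ∀ {M N} → R (app (lam M) N) (M [ N ]))
  (R-lam : ∀ {M M′} → R M M′ → R (lam M) (lam M′))
  (R-appˡ : ∀ {M M′ N} → R M M′ → R (app M N) (app M′ N))
  (R-appʳ : ∀ {M N N′} → R N N′ → R (app M N) (app M N′))
  where

  Conv-lam : ∀ {M N} → Conv R M N → Conv R (lam M) (lam N)
  Conv-lam = Conv-cong lam R-lam

  Conv-appʳ : ∀ {M N P} → Conv R M N → Conv R (app P M) (app P N)
  Conv-appʳ {P = P} = Conv-cong (app P) R-appʳ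

  app-id : ∀ {C X} → Conv R C (lam (var 0)) → Conv R (app C X) X
  app-id {X = X} c = trans (Conv-cong (λ M → app M X) R-appˡ c) (step R-β)

  coercion-essence : ∀ {T σ τ} (d : Sub T σ τ) → ArrowRulesOnlyIf (IdentityEta R) d →
                     Conv R ⌊ coercion d ⌋ (lam (var 0))
  coercion-essence refl        _ = refl
  coercion-essence incl₁       _ = refl
  coercion-essence incl₂       _ = refl
  coercion-essence (glb d e)   (g , _) = Conv-lam (app-id (coercion-essence d g))
  coercion-essence (trans d e) (g , h) =
    Conv-lam (trans (app-id (coercion-essence e h)) (app-id (coercion-essence d g)))
  coercion-essence (ωtop p)    _ = refl
  coercion-essence ω→          eta = eta
  coercion-essence (→∩ _)      eta = eta
  coercion-essence (arr _ d e) (eta , g , h) =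
    trans (Conv-lam (Conv-lam (trans (app-id (coercion-essence e h))
                                     (Conv-appʳ (app-id (coercion-essence d g))))))
          eta

  coercion-typed : ∀ {T σ τ} {Γ : List (Ty T)} (d : Sub T σ τ) →
                   ArrowRulesOnlyIf (IdentityEta R) d →
                   Typed (Conv R) Γ (coercion d) (σ ⇒ τ)
  coercion-typed refl        _ = →I (ax here)
  coercion-typed incl₁       _ = →I (∩E₁ (ax here))
  coercion-typed incl₂       _ = →I (∩E₂ (ax here))
  coercion-typed (glb d e)   (g , h) =
    →I (∩I (→E (coercion-typed d g) (ax here)) (→E (coercion-typed e h) (ax here))
           (trans (app-id (coercion-essence d g)) (sym (app-id (coercion-essence e h)))))
  coercion-typed (trans d e) (g , h) =
    →I (→E (coercion-typed e h) (→E (coercion-typed d g) (ax here)))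
  coercion-typed (ωtop p)    _ = →I (top p)
  coercion-typed ω→          _ = →I (→I (top tt))
  coercion-typed (→∩ _)      _ =
    →I (→I (∩I (→E (∩E₁ (ax (there here))) (ax here))
               (→E (∩E₂ (ax (there here))) (ax here)) refl))
  coercion-typed (arr _ d e) (_ , g , h) =
    →I (→I (→E (coercion-typed e h)
               (→E (ax (there here)) (→E (coercion-typed d g) (ax here)))))

module Coercions-βη = Coercions _→βη_ β ξlam ξappL ξappR
module Coercions-β  = Coercions _→β_ β ξlam ξappL ξappR

lemma5p6 : (∀ (T : Theory) (σ τ : Ty T) (d : Sub T σ τ) →
              Typed _=βη_ [] (coercion d) (σ ⇒ τ) × (⌊ coercion d ⌋ =βη lam (var 0)))
           × (∀ (T : Theory) (σ τ : Ty T) (d : Sub T σ τ) → NoArrowRules d →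
              Typed _=β_ [] (coercion d) (σ ⇒ τ) × (⌊ coercion d ⌋ =β lam (var 0)))
lemma5p6 = part₁ , part₂
  where
  part₁ : ∀ (T : Theory) (σ τ : Ty T) (d : Sub T σ τ) →
          Typed _=βη_ [] (coercion d) (σ ⇒ τ) × (⌊ coercion d ⌋ =βη lam (var 0))
  part₁ T σ τ d = Coercions-βη.coercion-typed d ok , Coercions-βη.coercion-essence d ok
    where
    ok : ArrowRulesOnlyIf (IdentityEta _→βη_) d
    ok = arrowRulesOnlyIf-holds identityEta-βη d

  part₂ : ∀ (T : Theory) (σ τ : Ty T) (d : Sub T σ τ) → NoArrowRules d →
          Typed _=β_ [] (coercion d) (σ ⇒ τ) × (⌊ coercion d ⌋ =β lam (var 0))
  part₂ T σ τ d n = Coercions-β.coercion-typed d ok , Coercions-β.coercion-essence d ok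
    where
    ok : ArrowRulesOnlyIf (IdentityEta _→β_) d
    ok = noArrowRules⇒arrowRulesOnlyIf d n
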